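{- For every finite multiset $\Gamma=\{\gamma_1,\dots,\gamma_k\}$ of formulae and every formula $\varphi$: if $!\Gamma\Vdash\varphi$, then $!\Gamma\Vdash\,!\varphi$, where $!\Gamma=\{!\gamma_1,\dots,!\gamma_k\}$ and $\Delta\Vdash\psi$ means $\Delta\Vdash^{\varnothing}_{\mathcal{B}}\psi$ for every base $\mathcal{B}$.
   Context: Fix a set $\mathbb{A}$ of propositional atoms. All multisets are finite; $\uplus$ denotes multiset union; an atomic multiset is a finite multiset of atoms. Formulae: $\varphi ::= p\in\mathbb{A}\mid\top\mid 0\mid 1\mid\varphi\multimap\varphi\mid\varphi\otimes\varphi\mid\varphi\mathbin{\&}\varphi\mid\varphi\oplus\varphi\mid\,!\varphi$. Bases. An atomic sequent is a pair $P\Rightarrow p$ ($P$ atomic multiset, $p$ atom); an atomic box is a finite multiset of atomic sequents; an atomic rule is a triple $\langle\mathbf{A},\mathbf{S},p\rangle$ with $\mathbf{A}$ a finite multiset of atomic boxes, $\mathbf{S}$ an atomic box, $p$ an atom. A base is a set of atomic rules; $\mathcal{C}\supseteq\mathcal{B}$ is set inclusion. An atom $p$ is persistent in $\mathcal{B}$ if $\mathcal{B}$ contains a rule $\langle\varnothing,\mathbf{S},p\rangle$ with $\mathbf{S}\neq\varnothing$. Derivability $P\vdash_{\mathcal{B}}p$ is the smallest relation closed under: (Ref) $\{p\}\vdash_{\mathcal{B}}p$; (App) if $\langle\mathbf{A},\mathbf{S},p\rangle\in\mathcal{B}$ with $\mathbf{A}=\{\mathbf{T}_1,\dots,\mathbf{T}_m\}$,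 and there are $n\ge m$, atomic multisets $C_1,\dots,C_n$ and a multiset $D=\{d_{m+1},\dots,d_n\}$ of atoms persistent in $\mathcal{B}$ with $C_i\uplus Q\vdash_{\mathcal{B}}q$ for all $i\le m$ and $Q\Rightarrow q\in\mathbf{T}_i$, $C_j\vdash_{\mathcal{B}}d_j$ for all $m<j\le n$, and $D\uplus U\vdash_{\mathcal{B}}v$ for all $U\Rightarrow v\in\mathbf{S}$, then $C_1\uplus\dots\uplus C_n\vdash_{\mathcal{B}}p$. Support. For a base $\mathcal{B}$, atomic multiset $L$: (At) $\Vdash^L_{\mathcal{B}}p$ iff $L\vdash_{\mathcal{B}}p$; ($\multimap$) $\Vdash^L_{\mathcal{B}}\varphi\multimap\psi$ iff $\varphi\Vdash^L_{\mathcal{B}}\psi$; ($\otimes$) $\Vdash^L_{\mathcal{B}}\varphi\otimes\psi$ iff for all $\mathcal{C}\supseteq\mathcal{B}$, atomic multisets $K$, atoms $p$: if $\{\varphi,\psi\}\Vdash^K_{\mathcal{C}}p$ then $\Vdash^{L\uplus K}_{\mathcal{C}}p$; ($1$) $\Vdash^L_{\mathcal{B}}1$ iff for all $\mathcal{C}\supseteq\mathcal{B}$, $K$, $p$: if $\Vdash^K_{\mathcal{C}}p$ then $\Vdash^{L\uplus K}_{\mathcal{C}}p$; ($\mathbin{\&}$) $\Vdash^L_{\mathcal{B}}\varphi\mathbin{\&}\psi$ iff $\Vdash^L_{\mathcal{B}}\varphi$ and $\Vdash^L_{\mathcal{B}}\psi$; ($\oplus$) $\Vdash^L_{\mathcal{B}}\varphi\oplus\psi$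 iff for all $\mathcal{C}\supseteq\mathcal{B}$, $K$, $p$: if $\varphi\Vdash^K_{\mathcal{C}}p$ and $\psi\Vdash^K_{\mathcal{C}}p$ then $\Vdash^{L\uplus K}_{\mathcal{C}}p$; ($0$) $\Vdash^L_{\mathcal{B}}0$ iff $\Vdash^{L\uplus K}_{\mathcal{B}}p$ for all atoms $p$ and atomic multisets $K$; ($\top$) $\Vdash^L_{\mathcal{B}}\top$ always; ($!$) $\Vdash^L_{\mathcal{B}}\,!\varphi$ iff for all $\mathcal{C}\supseteq\mathcal{B}$, $K$, $p$: if (for all $\mathcal{D}\supseteq\mathcal{C}$, $\Vdash^{\varnothing}_{\mathcal{D}}\varphi$ implies $\Vdash^K_{\mathcal{D}}p$) then $\Vdash^{L\uplus K}_{\mathcal{C}}p$. Multisets: $\Vdash^L_{\mathcal{B}}\varnothing$ iff $L=\varnothing$; $\Vdash^L_{\mathcal{B}}\{\varphi\}$ iff $\Vdash^L_{\mathcal{B}}\varphi$; $\Vdash^L_{\mathcal{B}}\Gamma\uplus\Delta$ iff $L=K\uplus M$ for some $K,M$ with $\Vdash^K_{\mathcal{B}}\Gamma$, $\Vdash^M_{\mathcal{B}}\Delta$. (Inf) For non-empty $\Gamma$, write $\Gamma=\,!\Delta\uplus\Theta$ with $!\Delta$ the elements whose top-level connective is $!$ and $\Theta$ the rest; $\Gamma\Vdash^L_{\mathcal{B}}\varphi$ iff for all $\mathcal{C}\supseteq\mathcal{B}$ and atomic $K$: if $\Vdash^{\varnothing}_{\mathcal{C}}\delta$ for every $\delta\in\Delta$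 and $\Vdash^K_{\mathcal{C}}\Theta$, then $\Vdash^{L\uplus K}_{\mathcal{C}}\varphi$. For $\Gamma=\varnothing$, $\Gamma\Vdash^L_{\mathcal{B}}\varphi$ means $\Vdash^L_{\mathcal{B}}\varphi$. -}

module Defs where

import Level
open import Level using (Lift; lift)
open import Data.Unit using (⊤)
open import Data.Product using (Σ; _×_; _,_; proj₁; proj₂)
open import Data.List using (List; []; _∷_; _++_; concat; map)
open import Data.List.Relation.Unary.All using (All)
open import Data.List.Relation.Binary.Pointwise using (Pointwise)
open import Data.List.Relation.Binary.Permutation.Propositional using (_↭_)
open import Relation.Binary.PropositionalEquality using (_≡_)
open import Relation.Nullary using (¬_)

-- Syntax and atomic objects, over an arbitrary set of atoms.
-- Finite multisets are represented by lists; multiset equality is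
-- permutation (_↭_) and multiset union is _++_.

module _ (Atom : Set) where

  infixr 25 _⊸_
  infixr 30 _⊗_ _&_ _⊕_
  infix  40 !_

  data Formula : Set where
    atom : Atom → Formula
    top  : Formula
    zero : Formula
    one  : Formula
    _⊸_  : Formula → Formula → Formula
    _⊗_  : Formula → Formula → Formula
    _&_  : Formula → Formula → Formula
    _⊕_  : Formula → Formula → Formula
    !_   : Formula → Formula

  Sequent : Set
  Sequent = List Atom × Atom

  Box : Set
  Box = List Sequent

  record Rule : Set where
    constructor ⟨_,_,_⟩
    field
      prems : List Box
      sbox  : Box
      concl : Atom

  Base : Set₁
  Base = Rule → Set

module _ {Atom : Set} where

  _⊆_ : Base Atom → Base Atom → Set
  B ⊆ C = ∀ r → B r → C r

  Persistent : Base Atom → Atom → Set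
  Persistent B p = Σ (Box Atom) λ S → ¬ (S ≡ []) × B ⟨ [] , S , p ⟩

  data Derive (B : Base Atom) : List Atom → Atom → Set where
    ref : ∀ {L p} → L ↭ (p ∷ []) → Derive B L p
    app : ∀ {L As S p}
          → B ⟨ As , S , p ⟩
          → (Cs : List (List Atom))
          → Pointwise (λ C T → All (λ s → Derive B (C ++ proj₁ s) (proj₂ s)) T) Cs As
          → (Es : List (List Atom × Atom))
          → All (λ e → Persistent B (proj₂ e) × Derive B (proj₁ e) (proj₂ e)) Es
          → All (λ s → Derive B (map proj₂ Es ++ proj₁ s) (proj₂ s)) S
          → L ↭ (concat Cs ++ concat (map proj₁ Es))
          → Derive B L p

  mutual
    Sup : Base Atom → List Atom → Formula Atom → Set₁
    Sup B L (atom p) = Lift (Level.suc Level.zero) (Derive B L p)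
    Sup B L top      = Lift (Level.suc Level.zero) ⊤
    Sup B L zero     = ∀ p K → Lift (Level.suc Level.zero) (Derive B (L ++ K) p)
    Sup B L one      = ∀ C → B ⊆ C → ∀ K p → Derive C K p → Derive C (L ++ K) p
    Sup B L (φ ⊸ ψ)  = ∀ C → B ⊆ C → ∀ K → Hyp C K φ → Sup C (L ++ K) ψ
    Sup B L (φ ⊗ ψ)  = ∀ C → B ⊆ C → ∀ K p
                       → (∀ C′ → C ⊆ C′ → ∀ K′
                            → Σ (List Atom) (λ K₁ → Σ (List Atom) λ K₂ →
                                 (K′ ↭ K₁ ++ K₂) × Hyp C′ K₁ φ × Hyp C′ K₂ ψ)
                            → Derive C′ (K ++ K′) p)
                       → Derive C (L ++ K) p
    Sup B L (φ & ψ)  = Sup B L φ × Sup B L ψ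
    Sup B L (φ ⊕ ψ)  = ∀ C → B ⊆ C → ∀ K p
                       → InfAt C K φ p → InfAt C K ψ p → Derive C (L ++ K) p
    Sup B L (! φ)    = ∀ C → B ⊆ C → ∀ K p
                       → (∀ D → C ⊆ D → Sup D [] φ → Derive D K p)
                       → Derive C (L ++ K) p

    -- the (Inf) clause's hypothesis for a single context formula χ given
    -- the resource K: if χ = !δ then δ is supported by ∅ and K = ∅ (since
    -- χ is not in Θ); otherwise ⊩^K χ.
    Hyp : Base Atom → List Atom → Formula Atom → Set₁
    Hyp C K (! δ) = Lift (Level.suc Level.zero) (K ≡ []) × Sup C [] δ
    Hyp C K φ     = Sup C K φ

    -- φ ⊩^K_C p  (Inf with singleton context)
    InfAt : Base Atom → List Atom → Formula Atom → Atom → Set₁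
    InfAt C K φ p = ∀ C′ → C ⊆ C′ → ∀ K′ → Hyp C′ K′ φ → Derive C′ (K ++ K′) p

  SupMS : Base Atom → List Atom → List (Formula Atom) → Set₁
  SupMS B L []      = Lift (Level.suc Level.zero) (L ≡ [])
  SupMS B L (φ ∷ Γ) = Σ (List Atom) λ K → Σ (List Atom) λ M →
                        (L ↭ K ++ M) × Sup B K φ × SupMS B M Γ

  bangs : List (Formula Atom) → List (Formula Atom)
  bangs []          = []
  bangs ((! δ) ∷ Γ) = δ ∷ bangs Γ
  bangs (_ ∷ Γ)     = bangs Γ

  nonBangs : List (Formula Atom) → List (Formula Atom)
  nonBangs []          = []
  nonBangs ((! δ) ∷ Γ) = nonBangs Γ
  nonBangs (φ ∷ Γ)     = φ ∷ nonBangs Γ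

  Inf : Base Atom → List Atom → List (Formula Atom) → Formula Atom → Set₁
  Inf B L [] φ = Sup B L φ
  Inf B L Γ@(_ ∷ _) φ = ∀ C → B ⊆ C → ∀ K
                        → All (λ δ → Sup C [] δ) (bangs Γ)
                        → SupMS C K (nonBangs Γ)
                        → Sup C (L ++ K) φ

  Valid : List (Formula Atom) → Formula Atom → Set₁
  Valid Γ φ = ∀ B → Inf B [] Γ φ

{-# OPTIONS --safe #-}
module Submission where

-- A fully banged context !Γ consumes no resources, so !Γ ⊩ φ says just that
-- every base supporting each γ ∈ Γ from ∅ supports φ from ∅.  Support is
-- monotone under base extension, so if B supports Γ then φ is supported from
-- ∅ in every extension of B, and that is all ⊩^∅_B !φ asks for: its
-- continuation, applied to the extension at hand, yields the goal.

open import Defs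
open import Data.List using (List; []; _∷_; _++_; map)
open import Data.List.Relation.Unary.All as All using (All; []; _∷_)
open import Data.List.Relation.Binary.Pointwise using (Pointwise; []; _∷_)
open import Data.Product using (_×_; _,_; proj₁; proj₂)
open import Level using (lift; lower)
open import Function using (_∘′_)
open import Relation.Binary.PropositionalEquality using (_≡_; refl; sym; cong; subst)

module _ {Atom : Set} where

  ⊆-refl : {B : Base Atom} → B ⊆ B
  ⊆-refl _ r = r

  ⊆-trans : {B C D : Base Atom} → B ⊆ C → C ⊆ D → B ⊆ D
  ⊆-trans B⊆C C⊆D r = C⊆D r ∘′ B⊆C r

  -- All.map (derive-mono B⊆C) would hide the recursive calls from the
  -- termination checker, hence the explicit traversals.
  mutual
    derive-mono : {B C : Base Atom} → B ⊆ C → ∀ {L p} → Derive B L p → Derive C L p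
    derive-mono B⊆C (ref L↭p) = ref L↭p
    derive-mono B⊆C (app r Cs prems Es persist sbox L↭) =
      app (B⊆C _ r) Cs (prems-mono B⊆C prems) Es (persistent-mono B⊆C persist)
          (box-mono B⊆C sbox) L↭

    box-mono : {B C : Base Atom} → B ⊆ C → ∀ {X : List Atom} {T : Box Atom}
             → All (λ s → Derive B (X ++ proj₁ s) (proj₂ s)) T
             → All (λ s → Derive C (X ++ proj₁ s) (proj₂ s)) T
    box-mono B⊆C []       = []
    box-mono B⊆C (d ∷ ds) = derive-mono B⊆C d ∷ box-mono B⊆C ds

    prems-mono : {B C : Base Atom} → B ⊆ C → ∀ {Cs As}
               → Pointwise (λ X T → All (λ s → Derive B (X ++ proj₁ s) (proj₂ s)) T) Cs As
               → Pointwise (λ X T → All (λ s → Derive C (X ++ proj₁ s) (proj₂ s)) T) Cs As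
    prems-mono B⊆C []         = []
    prems-mono B⊆C (ds ∷ dss) = box-mono B⊆C ds ∷ prems-mono B⊆C dss

    persistent-mono : {B C : Base Atom} → B ⊆ C → ∀ {Es : List (List Atom × Atom)}
                    → All (λ e → Persistent B (proj₂ e) × Derive B (proj₁ e) (proj₂ e)) Es
                    → All (λ e → Persistent C (proj₂ e) × Derive C (proj₁ e) (proj₂ e)) Es
    persistent-mono B⊆C [] = []
    persistent-mono B⊆C (((S , S≢[] , r) , d) ∷ es) =
      ((S , S≢[] , B⊆C _ r) , derive-mono B⊆C d) ∷ persistent-mono B⊆C es

  sup-mono : {B C : Base Atom} → B ⊆ C → ∀ {L} φ → Sup B L φ → Sup C L φ
  sup-mono B⊆C (atom p) d         = lift (derive-mono B⊆C (lower d))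
  sup-mono B⊆C top      t         = t
  sup-mono B⊆C zero     f         = λ p K → lift (derive-mono B⊆C (lower (f p K)))
  sup-mono B⊆C one      f         = λ D C⊆D → f D (⊆-trans B⊆C C⊆D)
  sup-mono B⊆C (φ ⊸ ψ)  f         = λ D C⊆D → f D (⊆-trans B⊆C C⊆D)
  sup-mono B⊆C (φ ⊗ ψ)  f         = λ D C⊆D → f D (⊆-trans B⊆C C⊆D)
  sup-mono B⊆C (φ & ψ)  (sφ , sψ) = sup-mono B⊆C φ sφ , sup-mono B⊆C ψ sψ
  sup-mono B⊆C (φ ⊕ ψ)  f         = λ D C⊆D → f D (⊆-trans B⊆C C⊆D)
  sup-mono B⊆C (! φ)    f         = λ D C⊆D → f D (⊆-trans B⊆C C⊆D)

  sup-!-intro : ∀ {B} φ → (∀ C → B ⊆ C → Sup C [] φ) → Sup B [] (! φ)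
  sup-!-intro φ sφ C B⊆C K p k = k C ⊆-refl (sφ C B⊆C)

  bangs-map-! : (Γ : List (Formula Atom)) → bangs (map !_ Γ) ≡ Γ
  bangs-map-! []      = refl
  bangs-map-! (γ ∷ Γ) = cong (γ ∷_) (bangs-map-! Γ)

  nonBangs-map-! : (Γ : List (Formula Atom)) → nonBangs (map !_ Γ) ≡ []
  nonBangs-map-! []      = refl
  nonBangs-map-! (γ ∷ Γ) = nonBangs-map-! Γ

  valid-!-elim : ∀ Γ {φ} → Valid (map !_ Γ) φ
               → ∀ B → All (Sup B []) Γ → Sup B [] φ
  valid-!-elim []        v B [] = v B
  valid-!-elim Γ@(_ ∷ _) v B sΓ =
    v B B ⊆-refl []
      (subst (All (Sup B [])) (sym (bangs-map-! Γ)) sΓ)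
      (subst (SupMS B []) (sym (nonBangs-map-! Γ)) (lift refl))

  valid-!-intro : ∀ Γ {φ} → (∀ B → All (Sup B []) Γ → Sup B [] φ)
                → Valid (map !_ Γ) φ
  valid-!-intro []        f B = f B []
  valid-!-intro Γ@(_ ∷ _) {φ} f B C B⊆C K sΓ sΘ =
    subst (λ K → Sup C K φ) (sym K≡[])
      (f C (subst (All (Sup C [])) (bangs-map-! Γ) sΓ))
    where
    K≡[] : K ≡ []
    K≡[] = lower (subst (SupMS C K) (nonBangs-map-! Γ) sΘ)

mainTheorem15 : {Atom : Set} (Γ : List (Formula Atom)) (φ : Formula Atom)
                → Valid (map !_ Γ) φ → Valid (map !_ Γ) (! φ)
mainTheorem15 Γ φ v = valid-!-intro Γ λ B sΓ → sup-!-intro φ λ C B⊆C →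
  valid-!-elim Γ v C (All.map (sup-mono B⊆C _) sΓ)
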